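{- For every graph $G$ without isolated vertices, $\gamma(G)\le\frac{1}{2}\tilde\gamma_{\times 2}(G)$.
   Context: $G=(V,E)$ finite simple graph; $N[v]$ closed neighborhood. $\gamma(G)$ is the minimum size of a dominating set (a set $D$ such that every vertex outside $D$ has a neighbor in $D$). $\tilde\gamma_{\times 2}(G)$ is the minimum of $\sum_v|f(v)|$ over $f:V\to\{\emptyset,\{a\},\{b\}\}$ with $\bigcup_{w\in N[v]}f(w)=\{a,b\}$ for all $v\in V$. -}

module Defs where

open import Data.Nat using (ℕ; _+_; _*_; _≤_)
open import Data.Fin using (Fin)
open import Data.Fin.Subset using (Subset; _∈_; ∣_∣)
open import Data.Bool using (Bool; true; false)
open import Data.Product using (Σ; ∃; _×_; _,_)
open import Data.Sum using (_⊎_)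
open import Data.Empty using (⊥)
open import Relation.Nullary using (¬_)
open import Relation.Binary.PropositionalEquality using (_≡_)
open import Data.Vec.Functional using (foldr)

record Graph (n : ℕ) : Set where
  field
    adj   : Fin n → Fin n → Bool
    sym   : ∀ u v → adj u v ≡ adj v u
    irrefl : ∀ v → adj v v ≡ false
open Graph public

Adj : ∀ {n} → Graph n → Fin n → Fin n → Set
Adj G u v = adj G u v ≡ true

InClosedNbhd : ∀ {n} → Graph n → Fin n → Fin n → Set
InClosedNbhd G v w = (w ≡ v) ⊎ Adj G v w

NoIsolatedVertices : ∀ {n} → Graph n → Set
NoIsolatedVertices G = ∀ v → ∃ λ w → Adj G v w

IsDominating : ∀ {n} → Graph n → Subset n → Set
IsDominating G D = ∀ v → ¬ (v ∈ D) → ∃ λ w → Adj G v w × w ∈ D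

-- Labels: ∅, {a}, {b}
data Label : Set where
  none : Label
  la   : Label
  lb   : Label

size : Label → ℕ
size none = 0
size la   = 1
size lb   = 1

-- Labelling f : V → {∅,{a},{b}} with ⋃_{w∈N[v]} f(w) = {a,b} for every v.
IsDoubleLabeling : ∀ {n} → Graph n → (Fin n → Label) → Set
IsDoubleLabeling G f = ∀ v →
  (∃ λ w → InClosedNbhd G v w × f w ≡ la) ×
  (∃ λ w → InClosedNbhd G v w × f w ≡ lb)

weight : ∀ {n} → (Fin n → Label) → ℕ
weight f = foldr _+_ 0 (λ v → size (f v))

IsMinDominating : ∀ {n} → Graph n → Subset n → Set
IsMinDominating G D = IsDominating G D × (∀ D′ → IsDominating G D′ → ∣ D ∣ ≤ ∣ D′ ∣)

IsMinDoubleLabeling : ∀ {n} → Graph n → (Fin n → Label) → Set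
IsMinDoubleLabeling G f = IsDoubleLabeling G f × (∀ g → IsDoubleLabeling G g → weight f ≤ weight g)

module Submission where

-- Let f be a labelling in which every closed neighbourhood N[v]
-- contains a vertex labelled a and a vertex labelled b.  Then the class
-- A = f⁻¹(a) meets every closed neighbourhood, and a set meeting every
-- closed neighbourhood is dominating; likewise for B = f⁻¹(b).  Since
-- f has weight |A| + |B| and each of A, B has at least γ(G) elements,
-- 2·γ(G) ≤ weight f.

open import Defs
open import Data.Nat using (ℕ; zero; suc; _*_; _≤_; _+_)
open import Data.Nat.Properties using (+-mono-≤; +-suc; +-identityʳ)
open import Data.Fin as Fin using (Fin)
open import Data.Fin.Subset using (Subset; ∣_∣; _∈_)
open import Data.Bool using (Bool; true; false)
open import Data.Vec using (tabulate; lookup)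
open import Data.Vec.Properties using (lookup∘tabulate; lookup⇒[]=)
open import Data.Product using (∃; _×_; _,_; proj₁; proj₂)
open import Data.Sum using (inj₁; inj₂)
open import Data.Empty using (⊥-elim)
open import Relation.Binary.PropositionalEquality
  using (_≡_; refl; cong; module ≡-Reasoning)

_==ᴸ_ : Label → Label → Bool
none ==ᴸ none = true
la   ==ᴸ la   = true
lb   ==ᴸ lb   = true
_    ==ᴸ _    = false

==ᴸ-refl : ∀ c → (c ==ᴸ c) ≡ true
==ᴸ-refl none = refl
==ᴸ-refl la   = refl
==ᴸ-refl lb   = refl

labelClass : ∀ {n} → (Fin n → Label) → Label → Subset n
labelClass f c = tabulate (λ v → f v ==ᴸ c)

∈-labelClass : ∀ {n} (f : Fin n → Label) {c : Label} (w : Fin n) →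
  f w ≡ c → w ∈ labelClass f c
∈-labelClass f w refl = lookup⇒[]= w _ (begin
  lookup (labelClass f (f w)) w ≡⟨ lookup∘tabulate (λ v → f v ==ᴸ f w) w ⟩
  f w ==ᴸ f w                   ≡⟨ ==ᴸ-refl (f w) ⟩
  true                          ∎)
  where open ≡-Reasoning

weight≡classSizes : ∀ n (f : Fin n → Label) →
  weight f ≡ ∣ labelClass f la ∣ + ∣ labelClass f lb ∣
weight≡classSizes zero    f = refl
weight≡classSizes (suc n) f
  with f Fin.zero | weight≡classSizes n (λ v → f (Fin.suc v))
... | none | ih = ih
... | la   | ih = cong suc ih
... | lb   | ih = begin
  suc (weight (λ v → f (Fin.suc v)))                    ≡⟨ cong suc ih ⟩
  suc (∣ labelClass f′ la ∣ + ∣ labelClass f′ lb ∣)     ≡⟨ +-suc _ _ ⟨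
  ∣ labelClass f′ la ∣ + suc ∣ labelClass f′ lb ∣       ∎
  where
  open ≡-Reasoning
  f′ : Fin n → Label
  f′ v = f (Fin.suc v)

closedNbhdHitting⇒dominating : ∀ {n} (G : Graph n) (S : Subset n) →
  (∀ v → ∃ λ w → InClosedNbhd G v w × w ∈ S) → IsDominating G S
closedNbhdHitting⇒dominating G S hits v v∉S with hits v
... | w , inj₁ refl , w∈S = ⊥-elim (v∉S w∈S)
... | w , inj₂ v~w  , w∈S = w , v~w , w∈S

labelClass-dominating : ∀ {n} (G : Graph n) (f : Fin n → Label) (c : Label) →
  (∀ v → ∃ λ w → InClosedNbhd G v w × f w ≡ c) →
  IsDominating G (labelClass f c)
labelClass-dominating G f c seesC =
  closedNbhdHitting⇒dominating G (labelClass f c) λ v →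
    let (w , w∈N[v] , fw≡c) = seesC v in w , w∈N[v] , ∈-labelClass f w fw≡c

mainTheorem19 : ∀ (n : ℕ) (G : Graph n) → NoIsolatedVertices G →
    (D : Subset n) → IsMinDominating G D →
    (f : Fin n → Label) → IsMinDoubleLabeling G f →
    2 * ∣ D ∣ ≤ weight f
mainTheorem19 n G _ D (_ , D-minimum) f (f-double , _)
  rewrite +-identityʳ ∣ D ∣ | weight≡classSizes n f =
  +-mono-≤ (D-minimum _ aClassDominates) (D-minimum _ bClassDominates)
  where
  aClassDominates : IsDominating G (labelClass f la)
  aClassDominates = labelClass-dominating G f la (λ v → proj₁ (f-double v))
  bClassDominates : IsDominating G (labelClass f lb)
  bClassDominates = labelClass-dominating G f lb (λ v → proj₂ (f-double v))
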